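{- Let $A=(a_i)_{i=1,\dots,n}$ be a sequence of distinct integers between $1$ and $n$ whose permutation graph $G_A$ is bipartite, and let $I,J$ be maximum feasible sets for $A$ such that $(A,I,J)$ has no forbidden pair. Let $a_i,a_j$ be the two elements of the leftmost mixed pile, with $i\in I$ and $j\in J$. Then at least one of $(I\setminus\{i\})\cup\{j\}$ and $(J\setminus\{j\})\cup\{i\}$ is feasible.
   Context: A set $I\subseteq[n]$ is feasible for $A$ if $a_u<a_v$ for all $u,v\in I$ with $u<v$; a maximum feasible set has maximum cardinality. The permutation graph $G_A$ has vertex set $[n]$ and an edge $\{u,v\}$ for $u<v$ iff $a_u>a_v$. Patience sorting: start with empty piles; for $i=1,\dots,n$ in this order, put $a_i$ on the top of the leftmost pile that is empty or whose current top element is greater than $a_i$; let $P_1,\dots,P_k$ be the resulting nonempty piles, indexed left to right. (When $G_A$ is bipartite each pile has at most two elements.) A pile $P_t$ is mixed if it contains exactly two elements $a_i,a_j$ with $i\in I$ and $j\in J$. A pair of mixed piles is a forbidden pair if the four vertices (indices) of their elements induce a cycle of length $4$ in $G_A$. A mixed pile $P_t$ is the leftmost mixed pile if no pile $P_s$ with $s<t$ is mixed. -}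

module Defs where

open import Data.Nat as ℕ using (ℕ; _<ᵇ_)
open import Data.Bool using (Bool; if_then_else_)
open import Data.Fin as Fin using (Fin)
open import Data.Fin.Subset using (Subset; _∈_; ∣_∣)
open import Data.List using (List; []; _∷_; foldl; allFin; length; lookup)
open import Data.Product using (Σ; _×_; _,_)
open import Data.Sum using (_⊎_)
open import Relation.Binary.PropositionalEquality using (_≡_; _≢_)
open import Relation.Nullary using (¬_)

-- A sequence A = (a_u) indexed by Fin n (index u ↔ u+1 of the paper);
-- the values a_u are natural numbers (hypotheses 1 ≤ a_u ≤ n, distinctness in the theorem).

module _ {n : ℕ} (a : Fin n → ℕ) where

  Feasible : Subset n → Set
  Feasible I = ∀ u v → u ∈ I → v ∈ I → u Fin.< v → a u ℕ.< a v

  MaxFeasible : Subset n → Set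
  MaxFeasible I = Feasible I × (∀ K → Feasible K → ∣ K ∣ ℕ.≤ ∣ I ∣)

  Edge : Fin n → Fin n → Set
  Edge u v = (u Fin.< v × a v ℕ.< a u) ⊎ (v Fin.< u × a u ℕ.< a v)

  Bipartite : Set
  Bipartite = Σ (Fin n → Bool) λ c → ∀ u v → Edge u v → c u ≢ c v

  -- Patience sorting. A pile is a list of indices, head = top element.
  place : List (List (Fin n)) → Fin n → List (List (Fin n))
  place [] i = (i ∷ []) ∷ []
  place ([] ∷ ps) i = (i ∷ []) ∷ ps
  place ((t ∷ rest) ∷ ps) i =
    if a i <ᵇ a t then (i ∷ t ∷ rest) ∷ ps else (t ∷ rest) ∷ place ps i

  -- the resulting piles P_1, …, P_k (left to right); all are nonempty
  piles : List (List (Fin n))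
  piles = foldl place [] (allFin n)

  TwoElems : List (Fin n) → Fin n → Fin n → Set
  TwoElems p i j = (p ≡ i ∷ j ∷ []) ⊎ (p ≡ j ∷ i ∷ [])

  Mixed : Subset n → Subset n → List (Fin n) → Set
  Mixed I J p = Σ (Fin n) λ i → Σ (Fin n) λ j → TwoElems p i j × i ∈ I × j ∈ J

  C4 : Fin n → Fin n → Fin n → Fin n → Set
  C4 x y z w = Edge x y × Edge y z × Edge z w × Edge w x × ¬ Edge x z × ¬ Edge y w

  -- four (distinct) vertices induce a cycle of length 4 (any of the 3 cyclic orders)
  InducesC4 : Fin n → Fin n → Fin n → Fin n → Set
  InducesC4 x y z w = C4 x y z w ⊎ C4 x y w z ⊎ C4 x z y w

  PilesInduceC4 : List (Fin n) → List (Fin n) → Set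
  PilesInduceC4 p q = Σ (Fin n) λ x → Σ (Fin n) λ y → Σ (Fin n) λ z → Σ (Fin n) λ w →
    TwoElems p x y × TwoElems q z w × InducesC4 x y z w

  NoForbiddenPair : Subset n → Subset n → Set
  NoForbiddenPair I J = ∀ (s t : Fin (length piles)) → s Fin.< t →
    Mixed I J (lookup piles s) → Mixed I J (lookup piles t) →
    ¬ PilesInduceC4 (lookup piles s) (lookup piles t)

  LeftmostMixed : Subset n → Subset n → Fin n → Fin n → Set
  LeftmostMixed I J i j = Σ (Fin (length piles)) λ t →
    TwoElems (lookup piles t) i j × i ∈ I × j ∈ J ×
    (∀ s → s Fin.< t → ¬ Mixed I J (lookup piles s))

{-# OPTIONS --safe #-}
module Submission where

-- Patience sorting puts every index on a pile so that an increasing pair (earlier index, smaller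
-- value) lands on a strictly later pile, while every element of pile p+1 is preceded by one of
-- pile p. Hence a maximum feasible set has exactly one element on each pile, and distinct
-- elements of one pile are adjacent in G_A, so bipartiteness leaves at most two per pile. Left
-- of the leftmost mixed pile P_t the sets I and J therefore coincide. If P_t is the last pile,
-- trading i for j in I keeps it feasible; otherwise let u ∈ I and v ∈ J lie on P_{t+1}. If j, u
-- are non-adjacent the trade in I works, if i, v are non-adjacent the trade in J works, and if
-- both pairs are adjacent then i, j, u, v induce a 4-cycle: P_t, P_{t+1} form a forbidden pair.

open import Defs
open import Data.Bool using (Bool; true; false; T; if_then_else_)
open import Data.Empty using (⊥; ⊥-elim)
open import Data.Fin as F using (Fin; toℕ)
import Data.Fin.Properties as FP
open import Data.Fin.Subset using (Subset; _-_; _∪_; ⁅_⁆; _∈_; _∉_; _─_; _⊂_; ∣_∣; inside; outside)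
import Data.Fin.Subset.Properties as SP
open import Data.List using (List; []; _∷_; length; lookup; foldl; tabulate)
open import Data.List.Membership.Propositional using () renaming (_∈_ to _∈ₗ_)
open import Data.List.Membership.Propositional.Properties using (∈-lookup)
open import Data.List.Relation.Unary.All as All using (All; []; _∷_)
open import Data.List.Relation.Unary.Any using (here; there)
open import Data.List.Relation.Unary.Linked using (Linked; [-]; _∷_)
open import Data.Nat using (ℕ; zero; suc; _+_; _≤_; _<_; _<?_; _<ᵇ_; z≤n; s≤s)
import Data.Nat.Properties as NP
open import Data.Product using (∃; _×_; _,_; proj₁; proj₂)
open import Data.Sum using (_⊎_; inj₁; inj₂)
open import Data.Unit using (⊤; tt)
open import Data.Vec using ([]; _∷_) renaming (here to hereᵥ; there to thereᵥ)
open import Function.Definitions using (Injective)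
open import Relation.Binary.Definitions using (tri<; tri≈; tri>)
open import Relation.Binary.PropositionalEquality using (_≡_; _≢_; refl; sym; trans; cong; subst; subst₂)
open import Relation.Nullary using (¬_; Dec; yes; no)
open import Relation.Nullary.Decidable using (_×-dec_; _⊎-dec_)

no-three-distinct-Bools : (x y z : Bool) → x ≢ y → y ≢ z → x ≢ z → ⊥
no-three-distinct-Bools false false _     x≢y _   _   = x≢y refl
no-three-distinct-Bools true  true  _     x≢y _   _   = x≢y refl
no-three-distinct-Bools false true  false _   _   x≢z = x≢z refl
no-three-distinct-Bools false true  true  _   y≢z _   = y≢z refl
no-three-distinct-Bools true  false false _   y≢z _   = y≢z refl
no-three-distinct-Bools true  false true  _   _   x≢z = x≢z refl

<ᵇ≡true⇒< : ∀ {m k} → (m <ᵇ k) ≡ true → m < k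
<ᵇ≡true⇒< {m} {k} eq = NP.<ᵇ⇒< m k (subst T (sym eq) tt)

<ᵇ≡false⇒≮ : ∀ {m k} → (m <ᵇ k) ≡ false → ¬ (m < k)
<ᵇ≡false⇒≮ eq m<k = subst T eq (NP.<⇒<ᵇ m<k)

<⇒≡suc : ∀ {m k} → m < k → ∃ λ q → k ≡ suc q
<⇒≡suc {k = suc q} _ = q , refl

x∈p─q⇒x∉q : ∀ {k} {x : Fin k} (p q : Subset k) → x ∈ p ─ q → x ∉ q
x∈p─q⇒x∉q (_ ∷ p) (inside ∷ q) () hereᵥ
x∈p─q⇒x∉q (_ ∷ p) (_      ∷ q) (thereᵥ x∈p─q) (thereᵥ x∈q) = x∈p─q⇒x∉q p q x∈p─q x∈q

x∈[p-y]∪⁅z⁆⁻ : ∀ {k} (p : Subset k) y z {x} → x ∈ (p - y) ∪ ⁅ z ⁆ → (x ∈ p × x ≢ y) ⊎ x ≡ z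
x∈[p-y]∪⁅z⁆⁻ p y z x∈ with SP.x∈p∪q⁻ (p - y) ⁅ z ⁆ x∈
... | inj₁ x∈p-y = inj₁ (SP.p─q⊆p p ⁅ y ⁆ x∈p-y , λ { refl → x∈p─q⇒x∉q p ⁅ y ⁆ x∈p-y (SP.x∈⁅x⁆ y) })
... | inj₂ x∈⁅z⁆ = inj₂ (SP.x∈⁅y⁆⇒x≡y z x∈⁅z⁆)

StrictlyIncreasingOn : ∀ {k} → (Fin k → ℕ) → Subset k → Set
StrictlyIncreasingOn f I = ∀ u v → u ∈ I → v ∈ I → u F.< v → f u < f v

module _ {k} {s : Bool} {I : Subset k} where

  onTail : ∀ {P : Fin (suc k) → Set} → (∀ u → u ∈ s ∷ I → P u) → ∀ u → u ∈ I → P (F.suc u)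
  onTail h u u∈I = h (F.suc u) (thereᵥ u∈I)

  increasingOnTail : ∀ {f} → StrictlyIncreasingOn f (s ∷ I) → StrictlyIncreasingOn (λ u → f (F.suc u)) I
  increasingOnTail f↑ u v u∈I v∈I u<v = f↑ (F.suc u) (F.suc v) (thereᵥ u∈I) (thereᵥ v∈I) (s≤s u<v)

increasing-into-interval⇒∣∣≤ : ∀ {k} (f : Fin k → ℕ) I {lo hi} → lo ≤ hi →
  (∀ u → u ∈ I → lo ≤ f u) → (∀ u → u ∈ I → f u < hi) → StrictlyIncreasingOn f I → lo + ∣ I ∣ ≤ hi
increasing-into-interval⇒∣∣≤ f [] {lo} lo≤hi _ _ _ = subst (_≤ _) (sym (NP.+-identityʳ lo)) lo≤hi
increasing-into-interval⇒∣∣≤ f (outside ∷ I) lo≤hi lo≤f f<hi f↑ =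
  increasing-into-interval⇒∣∣≤ (λ u → f (F.suc u)) I lo≤hi (onTail lo≤f) (onTail f<hi) (increasingOnTail f↑)
increasing-into-interval⇒∣∣≤ f (inside ∷ I) {lo} {hi} lo≤hi lo≤f f<hi f↑ = begin
  lo + suc ∣ I ∣      ≡⟨ NP.+-suc lo ∣ I ∣ ⟩
  suc lo + ∣ I ∣      ≤⟨ NP.+-monoˡ-≤ ∣ I ∣ (s≤s (lo≤f F.zero hereᵥ)) ⟩
  suc (f F.zero) + ∣ I ∣ ≤⟨ increasing-into-interval⇒∣∣≤ (λ u → f (F.suc u)) I (f<hi F.zero hereᵥ)
                          (λ u u∈I → f↑ F.zero (F.suc u) hereᵥ (thereᵥ u∈I) (s≤s z≤n))
                          (onTail f<hi) (increasingOnTail f↑) ⟩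
  hi                  ∎
  where open NP.≤-Reasoning

-- Closing the gap at s turns a map avoiding s into one with values in [1, hi).
module _ (s : ℕ) where

  skip : ℕ → ℕ
  skip x with x <? s
  ... | yes _ = suc x
  ... | no  _ = x

  private
    above-s : ∀ {y} → ¬ y < s → y ≢ s → s < y
    above-s y≮s y≢s = NP.≤∧≢⇒< (NP.≮⇒≥ y≮s) (λ s≡y → y≢s (sym s≡y))

  skip-positive : ∀ x → x ≢ s → 0 < skip x
  skip-positive x x≢s with x <? s
  ... | yes _   = s≤s z≤n
  ... | no  x≮s = NP.≤-<-trans z≤n (above-s x≮s x≢s)

  skip-< : ∀ {x hi} → x < hi → s < hi → skip x < hi
  skip-< {x} x<hi s<hi with x <? s
  ... | yes x<s = NP.≤-<-trans x<s s<hi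
  ... | no  _   = x<hi

  skip-increasing : ∀ {x y} → x < y → x ≢ s → y ≢ s → skip x < skip y
  skip-increasing {x} {y} x<y x≢s y≢s with x <? s | y <? s
  ... | yes _   | yes _   = s≤s x<y
  ... | yes x<s | no  y≮s = NP.≤-<-trans x<s (above-s y≮s y≢s)
  ... | no  x≮s | yes y<s = ⊥-elim (x≮s (NP.<-trans x<y y<s))
  ... | no  _   | no  _   = x<y

increasing-below-avoiding⇒∣∣< : ∀ {k} (f : Fin k → ℕ) I {s hi} → s < hi → (∀ u → u ∈ I → f u ≢ s) →
  (∀ u → u ∈ I → f u < hi) → StrictlyIncreasingOn f I → suc ∣ I ∣ ≤ hi
increasing-below-avoiding⇒∣∣< f I {s} s<hi f≢s f<hi f↑ =
  increasing-into-interval⇒∣∣≤ (λ u → skip s (f u)) I (NP.≤-<-trans z≤n s<hi)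
    (λ u u∈I → skip-positive s (f u) (f≢s u u∈I))
    (λ u u∈I → skip-< s (f<hi u u∈I) s<hi)
    (λ u v u∈I v∈I u<v → skip-increasing s (f↑ u v u∈I v∈I u<v) (f≢s u u∈I) (f≢s v v∈I))

Precedes : ∀ {n} → (Fin n → ℕ) → Fin n → Fin n → Set
Precedes a u v = u F.< v × a u < a v

module _ {n} {a : Fin n → ℕ} where

  Precedes-trans : ∀ {u v w} → Precedes a u v → Precedes a v w → Precedes a u w
  Precedes-trans (u<v , au<av) (v<w , av<aw) = NP.<-trans u<v v<w , NP.<-trans au<av av<aw

  Edge-sym : ∀ {u v} → Edge a u v → Edge a v u
  Edge-sym (inj₁ e) = inj₂ e
  Edge-sym (inj₂ e) = inj₁ e

  Edge? : ∀ u v → Dec (Edge a u v)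
  Edge? u v = ((u F.<? v) ×-dec (a v <? a u)) ⊎-dec ((v F.<? u) ×-dec (a u <? a v))

  Precedes⇒¬Edge : ∀ {u v} → Precedes a u v → ¬ Edge a u v
  Precedes⇒¬Edge (_ , au<av) (inj₁ (_ , av<au)) = NP.<-asym au<av av<au
  Precedes⇒¬Edge (u<v , _) (inj₂ (v<u , _)) = NP.<-asym u<v v<u

  Feasible⇒¬Edge : ∀ {K u v} → Feasible a K → u ∈ K → v ∈ K → ¬ Edge a u v
  Feasible⇒¬Edge fK u∈K v∈K (inj₁ (u<v , av<au)) = NP.<-asym av<au (fK _ _ u∈K v∈K u<v)
  Feasible⇒¬Edge fK u∈K v∈K (inj₂ (v<u , au<av)) = NP.<-asym au<av (fK _ _ v∈K u∈K v<u)

  Feasible-⁅⁆ : ∀ e → Feasible a ⁅ e ⁆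
  Feasible-⁅⁆ e u v u∈ v∈ u<v with SP.x∈⁅y⁆⇒x≡y e u∈ | SP.x∈⁅y⁆⇒x≡y e v∈
  ... | refl | refl = ⊥-elim (NP.<-irrefl refl u<v)

  Feasible-∪⁅⁆ : ∀ {K e} → Feasible a K → (∀ u → u ∈ K → Precedes a u e) → Feasible a (K ∪ ⁅ e ⁆)
  Feasible-∪⁅⁆ {K} {e} fK u≺e u v u∈ v∈ u<v
    with SP.x∈p∪q⁻ K ⁅ e ⁆ u∈ | SP.x∈p∪q⁻ K ⁅ e ⁆ v∈
  ... | inj₁ u∈K | inj₁ v∈K = fK u v u∈K v∈K u<v
  ... | inj₁ u∈K | inj₂ v∈e with SP.x∈⁅y⁆⇒x≡y e v∈e
  ...   | refl = proj₂ (u≺e u u∈K)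
  Feasible-∪⁅⁆ {K} {e} fK u≺e u v u∈ v∈ u<v | inj₂ u∈e | inj₁ v∈K with SP.x∈⁅y⁆⇒x≡y e u∈e
  ...   | refl = ⊥-elim (NP.<-asym u<v (proj₁ (u≺e v v∈K)))
  Feasible-∪⁅⁆ {K} {e} fK u≺e u v u∈ v∈ u<v | inj₂ u∈e | inj₂ v∈e
    with SP.x∈⁅y⁆⇒x≡y e u∈e | SP.x∈⁅y⁆⇒x≡y e v∈e
  ...   | refl | refl = ⊥-elim (NP.<-irrefl refl u<v)

  no-triangle : Bipartite a → ∀ {x y z} → Edge a x y → Edge a y z → Edge a x z → ⊥
  no-triangle (_ , proper) xy yz xz =
    no-three-distinct-Bools _ _ _ (proper _ _ xy) (proper _ _ yz) (proper _ _ xz)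

  TwoElems⇒∈ : ∀ {P i j} → TwoElems a P i j → i ∈ₗ P × j ∈ₗ P
  TwoElems⇒∈ (inj₁ refl) = here refl , there (here refl)
  TwoElems⇒∈ (inj₂ refl) = there (here refl) , here refl

  bipartite-clique⇒TwoElems : Bipartite a → ∀ P → Linked (λ x y → toℕ y < toℕ x) P →
    (∀ {x y} → x ∈ₗ P → y ∈ₗ P → x ≢ y → Edge a x y) → ∀ {v w} → v ∈ₗ P → w ∈ₗ P → v ≢ w → TwoElems a P v w
  bipartite-clique⇒TwoElems _ (x ∷ [])     _ _ (here refl) (here refl) v≢w = ⊥-elim (v≢w refl)
  bipartite-clique⇒TwoElems _ (x ∷ y ∷ []) _ _ (here refl) (here refl) v≢w = ⊥-elim (v≢w refl)
  bipartite-clique⇒TwoElems _ (x ∷ y ∷ []) _ _ (here refl) (there (here refl)) _ = inj₁ refl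
  bipartite-clique⇒TwoElems _ (x ∷ y ∷ []) _ _ (there (here refl)) (here refl) _ = inj₂ refl
  bipartite-clique⇒TwoElems _ (x ∷ y ∷ []) _ _ (there (here refl)) (there (here refl)) v≢w = ⊥-elim (v≢w refl)
  bipartite-clique⇒TwoElems bip (x ∷ y ∷ z ∷ _) (y<x ∷ z<y ∷ _) clique _ _ _ =
    ⊥-elim (no-triangle bip (clique x∈ y∈ (≢-by y<x)) (clique y∈ z∈ (≢-by z<y))
                            (clique x∈ z∈ (≢-by (NP.<-trans z<y y<x))))
    where
    x∈ = here refl
    y∈ = there (here refl)
    z∈ = there (there (here refl))
    ≢-by : ∀ {u v} → toℕ v < toℕ u → u ≢ v
    ≢-by v<u refl = NP.<-irrefl refl v<u

  module _ (a-injective : Injective _≡_ _≡_ a) where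

    ¬Edge⇒increasing : ∀ {u v} → u F.< v → ¬ Edge a u v → a u < a v
    ¬Edge⇒increasing {u} {v} u<v ¬uv with NP.<-cmp (a u) (a v)
    ... | tri< au<av _ _ = au<av
    ... | tri≈ _ au≡av _ = ⊥-elim (NP.<-irrefl (cong toℕ (a-injective au≡av)) u<v)
    ... | tri> _ _ av<au = ⊥-elim (¬uv (inj₁ (u<v , av<au)))

    ¬Edge⇒Precedes⊎Precedes : ∀ {u v} → u ≢ v → ¬ Edge a u v → Precedes a u v ⊎ Precedes a v u
    ¬Edge⇒Precedes⊎Precedes {u} {v} u≢v ¬uv with NP.<-cmp (toℕ u) (toℕ v)
    ... | tri< u<v _ _ = inj₁ (u<v , ¬Edge⇒increasing u<v ¬uv)
    ... | tri≈ _ u≡v _ = ⊥-elim (u≢v (FP.toℕ-injective u≡v))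
    ... | tri> _ _ v<u = inj₂ (v<u , ¬Edge⇒increasing v<u (λ vu → ¬uv (Edge-sym vu)))

    swap-feasible : ∀ {I} i j → Feasible a I → (∀ w → w ∈ I → w ≢ i → ¬ Edge a w j) →
                    Feasible a ((I - i) ∪ ⁅ j ⁆)
    swap-feasible {I} i j fI indep u v u∈ v∈ u<v
      with x∈[p-y]∪⁅z⁆⁻ I i j u∈ | x∈[p-y]∪⁅z⁆⁻ I i j v∈
    ... | inj₁ (u∈I , _)   | inj₁ (v∈I , _)   = fI u v u∈I v∈I u<v
    ... | inj₁ (u∈I , u≢i) | inj₂ refl        = ¬Edge⇒increasing u<v (indep u u∈I u≢i)
    ... | inj₂ refl        | inj₁ (v∈I , v≢i) = ¬Edge⇒increasing u<v (λ jv → indep v v∈I v≢i (Edge-sym jv))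
    ... | inj₂ refl        | inj₂ refl        = ⊥-elim (NP.<-irrefl refl u<v)

module PatienceSorting {n} (a : Fin n → ℕ) where

  Piles : Set
  Piles = List (List (Fin n))

  data InPile : Piles → ℕ → Fin n → Set where
    inHead : ∀ {P S e} → e ∈ₗ P → InPile (P ∷ S) 0 e
    inTail : ∀ {P S p e} → InPile S p e → InPile (P ∷ S) (suc p) e

  data OnTop : Piles → ℕ → Fin n → Set where
    topHead : ∀ {t P S} → OnTop ((t ∷ P) ∷ S) 0 t
    topTail : ∀ {P S p t} → OnTop S p t → OnTop (P ∷ S) (suc p) t

  slot : Piles → Fin n → ℕ
  slot []              x = 0
  slot ([] ∷ S)        x = 0
  slot ((t ∷ P) ∷ S)   x = if a x <ᵇ a t then 0 else suc (slot S x)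

  NonEmpty : List (Fin n) → Set
  NonEmpty []      = ⊥
  NonEmpty (_ ∷ _) = ⊤

  WellFormedPile : List (Fin n) → Set
  WellFormedPile P = NonEmpty P × Linked (λ x y → toℕ y < toℕ x) P

  InPile⇒<length : ∀ {S p e} → InPile S p e → p < length S
  InPile⇒<length (inHead _)  = s≤s z≤n
  InPile⇒<length (inTail e∈) = s≤s (InPile⇒<length e∈)

  OnTop⇒InPile : ∀ {S p t} → OnTop S p t → InPile S p t
  OnTop⇒InPile topHead      = inHead (here refl)
  OnTop⇒InPile (topTail tp) = inTail (OnTop⇒InPile tp)

  OnTop-exists : ∀ {S p} → All WellFormedPile S → p < length S → ∃ (OnTop S p)
  OnTop-exists {[] ∷ _}      {zero}  ((() , _) ∷ _) _
  OnTop-exists {(t ∷ _) ∷ _} {zero}  _              _        = t , topHead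
  OnTop-exists {_ ∷ _}       {suc p} (_ ∷ wf)       (s≤s p<) with OnTop-exists wf p<
  ... | t , tp = t , topTail tp

  slot≤length : ∀ S x → slot S x ≤ length S
  slot≤length []            x = z≤n
  slot≤length ([] ∷ S)      x = z≤n
  slot≤length ((t ∷ P) ∷ S) x with a x <ᵇ a t
  ... | true  = z≤n
  ... | false = s≤s (slot≤length S x)

  InPile-place⁻ : ∀ S x {p e} → InPile (place a S x) p e → InPile S p e ⊎ (e ≡ x × p ≡ slot S x)
  InPile-place⁻ []            x (inHead (here refl)) = inj₂ (refl , refl)
  InPile-place⁻ ([] ∷ S)      x (inHead (here refl)) = inj₂ (refl , refl)
  InPile-place⁻ ([] ∷ S)      x (inTail e∈)          = inj₁ (inTail e∈)
  InPile-place⁻ ((t ∷ P) ∷ S) x e∈ with a x <ᵇ a t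
  ... | true with e∈
  ...   | inHead (here refl)  = inj₂ (refl , refl)
  ...   | inHead (there e∈P)  = inj₁ (inHead e∈P)
  ...   | inTail e∈S          = inj₁ (inTail e∈S)
  InPile-place⁻ ((t ∷ P) ∷ S) x e∈ | false with e∈
  ...   | inHead e∈P = inj₁ (inHead e∈P)
  ...   | inTail e∈S with InPile-place⁻ S x e∈S
  ...     | inj₁ old              = inj₁ (inTail old)
  ...     | inj₂ (e≡x , p≡slot)   = inj₂ (e≡x , cong suc p≡slot)

  InPile-place⁺ : ∀ S x {p e} → InPile S p e → InPile (place a S x) p e
  InPile-place⁺ ([] ∷ S)      x (inHead ())
  InPile-place⁺ ([] ∷ S)      x (inTail e∈) = inTail e∈
  InPile-place⁺ ((t ∷ P) ∷ S) x e∈ with a x <ᵇ a t | e∈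
  ... | true  | inHead e∈P = inHead (there e∈P)
  ... | true  | inTail e∈S = inTail e∈S
  ... | false | inHead e∈P = inHead e∈P
  ... | false | inTail e∈S = inTail (InPile-place⁺ S x e∈S)

  OnTop-place-slot : ∀ S x → OnTop (place a S x) (slot S x) x
  OnTop-place-slot []            x = topHead
  OnTop-place-slot ([] ∷ S)      x = topHead
  OnTop-place-slot ((t ∷ P) ∷ S) x with a x <ᵇ a t
  ... | true  = topHead
  ... | false = topTail (OnTop-place-slot S x)

  OnTop-place⁻ : ∀ S x {p t} → OnTop (place a S x) p t → (p ≢ slot S x × OnTop S p t) ⊎ (t ≡ x × p ≡ slot S x)
  OnTop-place⁻ []            x topHead      = inj₂ (refl , refl)
  OnTop-place⁻ ([] ∷ S)      x topHead      = inj₂ (refl , refl)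
  OnTop-place⁻ ([] ∷ S)      x (topTail tp) = inj₁ ((λ ()) , topTail tp)
  OnTop-place⁻ ((t ∷ P) ∷ S) x tp with a x <ᵇ a t | tp
  ... | true  | topHead       = inj₂ (refl , refl)
  ... | true  | topTail tp₀   = inj₁ ((λ ()) , topTail tp₀)
  ... | false | topHead       = inj₁ ((λ ()) , topHead)
  ... | false | topTail tp₀ with OnTop-place⁻ S x tp₀
  ...   | inj₁ (p≢slot , old) = inj₁ ((λ eq → p≢slot (NP.suc-injective eq)) , topTail old)
  ...   | inj₂ (t≡x , p≡slot) = inj₂ (t≡x , cong suc p≡slot)

  OnTop-left-of-slot : ∀ S x {p t} → OnTop S p t → p < slot S x → ¬ (a x < a t)
  OnTop-left-of-slot ((t ∷ P) ∷ S) x tp p< with a x <ᵇ a t in eq | tp | p<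
  ... | false | topHead     | _        = <ᵇ≡false⇒≮ eq
  ... | false | topTail tp₀ | s≤s p<₀  = OnTop-left-of-slot S x tp₀ p<₀

  OnTop-at-slot : ∀ S x {t} → OnTop S (slot S x) t → a x < a t
  OnTop-at-slot ((t ∷ P) ∷ S) x tp with a x <ᵇ a t in eq | tp
  ... | true  | topHead     = <ᵇ≡true⇒< eq
  ... | false | topTail tp₀ = OnTop-at-slot S x tp₀

  place-WellFormed : ∀ S x → All WellFormedPile S → (∀ {p e} → InPile S p e → toℕ e < toℕ x) →
                     All WellFormedPile (place a S x)
  place-WellFormed []            x wf       _     = (tt , [-]) ∷ []
  place-WellFormed ([] ∷ S)      x (_ ∷ wf) _     = (tt , [-]) ∷ wf
  place-WellFormed ((t ∷ P) ∷ S) x (w ∷ wf) below with a x <ᵇ a t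
  ... | true  = (tt , below (inHead (here refl)) ∷ proj₂ w) ∷ wf
  ... | false = w ∷ place-WellFormed S x wf (λ e∈ → below (inTail e∈))

  lookup⇒InPile : ∀ S (t : Fin (length S)) {e} → e ∈ₗ lookup S t → InPile S (toℕ t) e
  lookup⇒InPile (P ∷ S) F.zero    e∈ = inHead e∈
  lookup⇒InPile (P ∷ S) (F.suc t) e∈ = inTail (lookup⇒InPile S t e∈)

  InPile⇒lookup : ∀ S (t : Fin (length S)) {e} → InPile S (toℕ t) e → e ∈ₗ lookup S t
  InPile⇒lookup (P ∷ S) F.zero    (inHead e∈) = e∈
  InPile⇒lookup (P ∷ S) (F.suc t) (inTail e∈) = InPile⇒lookup S t e∈

module PileStructure {n} {a : Fin n → ℕ} (a-injective : Injective _≡_ _≡_ a) where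

  open PatienceSorting a

  record Invariant (m : ℕ) (S : Piles) : Set where
    field
      indices-below : ∀ {p e} → InPile S p e → toℕ e < m
      well-formed   : All WellFormedPile S
      top-minimal   : ∀ {p q t d} → OnTop S p t → p ≤ q → InPile S q d → a t ≤ a d
      pile-unique   : ∀ {p q e} → InPile S p e → InPile S q e → p ≡ q
      Precedes⇒<    : ∀ {p q d e} → InPile S p d → InPile S q e → Precedes a d e → p < q
      predecessor   : ∀ {q e} → InPile S (suc q) e → ∃ λ d → InPile S q d × Precedes a d e
      placed        : ∀ e → toℕ e < m → ∃ λ p → InPile S p e

  invariant-[] : Invariant 0 []
  invariant-[] = record
    { indices-below = λ () ; well-formed = [] ; top-minimal = λ () ; pile-unique = λ ()
    ; Precedes⇒< = λ () ; predecessor = λ () ; placed = λ _ () }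

  module Place {m} {S : Piles} {x : Fin n} (inv : Invariant m S) (x≡m : toℕ x ≡ m) where
    open Invariant inv

    private
      S⁺ = place a S x

    old≢x : ∀ {p e} → InPile S p e → e ≢ x
    old≢x e∈ refl = NP.<-irrefl x≡m (indices-below e∈)

    old-before-x : ∀ {p e} → InPile S p e → e F.< x
    old-before-x e∈ = subst (_ <_) (sym x≡m) (indices-below e∈)

    indices-below⁺ : ∀ {p e} → InPile S⁺ p e → toℕ e < suc m
    indices-below⁺ e∈ with InPile-place⁻ S x e∈
    ... | inj₁ old          = NP.m<n⇒m<1+n (indices-below old)
    ... | inj₂ (refl , _)   = NP.≤-reflexive (cong suc x≡m)

    right-of-slot-above-x : ∀ {p d} → InPile S p d → slot S x ≤ p → a x < a d
    right-of-slot-above-x d∈ slot≤p with OnTop-exists well-formed (NP.≤-<-trans slot≤p (InPile⇒<length d∈))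
    ... | t , tp = NP.<-≤-trans (OnTop-at-slot S x tp) (top-minimal tp slot≤p d∈)

    top-minimal⁺ : ∀ {p q t d} → OnTop S⁺ p t → p ≤ q → InPile S⁺ q d → a t ≤ a d
    top-minimal⁺ tp p≤q d∈ with OnTop-place⁻ S x tp | InPile-place⁻ S x d∈
    ... | inj₁ (_ , tp₀)       | inj₁ d∈₀          = top-minimal tp₀ p≤q d∈₀
    ... | inj₁ (p≢slot , tp₀)  | inj₂ (refl , refl) =
            NP.≮⇒≥ (OnTop-left-of-slot S x tp₀ (NP.≤∧≢⇒< p≤q p≢slot))
    ... | inj₂ (refl , refl)   | inj₁ d∈₀          = NP.<⇒≤ (right-of-slot-above-x d∈₀ p≤q)
    ... | inj₂ (refl , refl)   | inj₂ (refl , _)   = NP.≤-refl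

    pile-unique⁺ : ∀ {p q e} → InPile S⁺ p e → InPile S⁺ q e → p ≡ q
    pile-unique⁺ e∈ e∈′ with InPile-place⁻ S x e∈ | InPile-place⁻ S x e∈′
    ... | inj₁ old | inj₁ old′            = pile-unique old old′
    ... | inj₁ old | inj₂ (e≡x , _)       = ⊥-elim (old≢x old e≡x)
    ... | inj₂ (e≡x , _) | inj₁ old′      = ⊥-elim (old≢x old′ e≡x)
    ... | inj₂ (_ , p≡) | inj₂ (_ , q≡)   = trans p≡ (sym q≡)

    Precedes⇒<⁺ : ∀ {p q d e} → InPile S⁺ p d → InPile S⁺ q e → Precedes a d e → p < q
    Precedes⇒<⁺ {p} d∈ e∈ d≺e with InPile-place⁻ S x d∈ | InPile-place⁻ S x e∈
    ... | inj₁ d∈₀ | inj₁ e∈₀             = Precedes⇒< d∈₀ e∈₀ d≺e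
    ... | inj₂ (refl , _) | inj₁ e∈₀      = ⊥-elim (NP.<-asym (proj₁ d≺e) (old-before-x e∈₀))
    ... | inj₂ (refl , _) | inj₂ (refl , _) = ⊥-elim (NP.<-irrefl refl (proj₁ d≺e))
    ... | inj₁ d∈₀ | inj₂ (refl , refl) with NP.<-cmp p (slot S x)
    ...   | tri< p<slot _ _ = p<slot
    ...   | tri≈ _ p≡slot _ = ⊥-elim (NP.<-asym (proj₂ d≺e) (right-of-slot-above-x d∈₀ (NP.≤-reflexive (sym p≡slot))))
    ...   | tri> _ _ slot<p = ⊥-elim (NP.<-asym (proj₂ d≺e) (right-of-slot-above-x d∈₀ (NP.<⇒≤ slot<p)))

    predecessor⁺ : ∀ {q e} → InPile S⁺ (suc q) e → ∃ λ d → InPile S⁺ q d × Precedes a d e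
    predecessor⁺ e∈ with InPile-place⁻ S x e∈
    ... | inj₁ e∈₀ with predecessor e∈₀
    ...   | d , d∈ , d≺e = d , InPile-place⁺ S x d∈ , d≺e
    predecessor⁺ {q} e∈ | inj₂ (refl , q+1≡slot) = t , InPile-place⁺ S x t∈ , old-before-x t∈ , at<ax
      where
      -- x is preceded by the top t of the pile just left of its slot
      q<slot : q < slot S x
      q<slot = subst (q <_) q+1≡slot (NP.n<1+n q)
      top : ∃ (OnTop S q)
      top = OnTop-exists well-formed (NP.<-≤-trans q<slot (slot≤length S x))
      t = proj₁ top
      t∈ = OnTop⇒InPile (proj₂ top)
      at<ax : a t < a x
      at<ax = NP.≤∧≢⇒< (NP.≮⇒≥ (OnTop-left-of-slot S x (proj₂ top) q<slot))
                        (λ at≡ax → old≢x t∈ (a-injective at≡ax))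

    placed⁺ : ∀ e → toℕ e < suc m → ∃ λ p → InPile S⁺ p e
    placed⁺ e (s≤s e≤m) with NP.m≤n⇒m<n∨m≡n e≤m
    ... | inj₁ e<m with placed e e<m
    ...   | p , e∈ = p , InPile-place⁺ S x e∈
    placed⁺ e (s≤s e≤m) | inj₂ e≡m with FP.toℕ-injective (trans e≡m (sym x≡m))
    ... | refl = slot S x , OnTop⇒InPile (OnTop-place-slot S x)

    invariant : Invariant (suc m) S⁺
    invariant = record
      { indices-below = indices-below⁺
      ; well-formed   = place-WellFormed S x well-formed old-before-x
      ; top-minimal   = top-minimal⁺
      ; pile-unique   = pile-unique⁺
      ; Precedes⇒<    = Precedes⇒<⁺
      ; predecessor   = predecessor⁺
      ; placed        = placed⁺ }

  data IndicesFrom : ℕ → List (Fin n) → Set where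
    done : IndicesFrom n []
    next : ∀ {m x xs} → toℕ x ≡ m → IndicesFrom (suc m) xs → IndicesFrom m (x ∷ xs)

  Invariant-foldl : ∀ {m S xs} → Invariant m S → IndicesFrom m xs → Invariant n (foldl (place a) S xs)
  Invariant-foldl inv done             = inv
  Invariant-foldl inv (next x≡m rest) = Invariant-foldl (Place.invariant inv x≡m) rest

  tabulate-IndicesFrom : ∀ k m (f : Fin k → Fin n) → (∀ i → toℕ (f i) ≡ m + toℕ i) → m + k ≡ n →
                         IndicesFrom m (tabulate f)
  tabulate-IndicesFrom zero    m f f≡ m+0≡n =
    subst (λ l → IndicesFrom l []) (trans (sym m+0≡n) (NP.+-identityʳ m)) done
  tabulate-IndicesFrom (suc k) m f f≡ m+k≡n =
    next (trans (f≡ F.zero) (NP.+-identityʳ m))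
         (tabulate-IndicesFrom k (suc m) (λ i → f (F.suc i)) (λ i → trans (f≡ (F.suc i)) (NP.+-suc m (toℕ i)))
                               (trans (sym (NP.+-suc m k)) m+k≡n))

  -- piles a folds place over allFin n, which is tabulate id
  piles-invariant : Invariant n (piles a)
  piles-invariant = Invariant-foldl invariant-[] (tabulate-IndicesFrom n 0 (λ i → i) (λ _ → refl) refl)

  open Invariant piles-invariant

  #piles : ℕ
  #piles = length (piles a)

  pileOf : Fin n → ℕ
  pileOf e = proj₁ (placed e (FP.toℕ<n e))

  InPile-pileOf : ∀ e → InPile (piles a) (pileOf e) e
  InPile-pileOf e = proj₂ (placed e (FP.toℕ<n e))

  pileOf-unique : ∀ {p e} → InPile (piles a) p e → pileOf e ≡ p
  pileOf-unique = pile-unique (InPile-pileOf _)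

  pileOf<#piles : ∀ e → pileOf e < #piles
  pileOf<#piles e = InPile⇒<length (InPile-pileOf e)

  Precedes⇒pileOf< : ∀ {u v} → Precedes a u v → pileOf u < pileOf v
  Precedes⇒pileOf< = Precedes⇒< (InPile-pileOf _) (InPile-pileOf _)

  pileOf≡⇒Edge : ∀ {u v} → u ≢ v → pileOf u ≡ pileOf v → Edge a u v
  pileOf≡⇒Edge {u} {v} u≢v πu≡πv with Edge? u v
  ... | yes uv = uv
  ... | no ¬uv with ¬Edge⇒Precedes⊎Precedes a-injective u≢v ¬uv
  ...   | inj₁ u≺v = ⊥-elim (NP.<-irrefl πu≡πv (Precedes⇒pileOf< u≺v))
  ...   | inj₂ v≺u = ⊥-elim (NP.<-irrefl (sym πu≡πv) (Precedes⇒pileOf< v≺u))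

  pileOf<∧¬Edge⇒Precedes : ∀ {u v} → pileOf u < pileOf v → ¬ Edge a u v → Precedes a u v
  pileOf<∧¬Edge⇒Precedes πu<πv ¬uv
    with ¬Edge⇒Precedes⊎Precedes a-injective (λ { refl → NP.<-irrefl refl πu<πv }) ¬uv
  ... | inj₁ u≺v = u≺v
  ... | inj₂ v≺u = ⊥-elim (NP.<-asym πu<πv (Precedes⇒pileOf< v≺u))

  module _ {I} (fI : Feasible a I) where

    Feasible⇒pileOf-increasing : StrictlyIncreasingOn pileOf I
    Feasible⇒pileOf-increasing u v u∈I v∈I u<v = Precedes⇒pileOf< (u<v , fI u v u∈I v∈I u<v)

    Feasible⇒one-per-pile : ∀ {u v} → u ∈ I → v ∈ I → pileOf u ≡ pileOf v → u ≡ v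
    Feasible⇒one-per-pile {u} {v} u∈I v∈I πu≡πv with u F.≟ v
    ... | yes u≡v = u≡v
    ... | no  u≢v = ⊥-elim (Feasible⇒¬Edge fI u∈I v∈I (pileOf≡⇒Edge u≢v πu≡πv))

    Feasible⇒≡⊎Precedes : ∀ {u v} → u ∈ I → v ∈ I → pileOf u ≤ pileOf v → u ≡ v ⊎ Precedes a u v
    Feasible⇒≡⊎Precedes u∈I v∈I πu≤πv with NP.m≤n⇒m<n∨m≡n πu≤πv
    ... | inj₁ πu<πv = inj₂ (pileOf<∧¬Edge⇒Precedes πu<πv (Feasible⇒¬Edge fI u∈I v∈I))
    ... | inj₂ πu≡πv = inj₁ (Feasible⇒one-per-pile u∈I v∈I πu≡πv)

    ¬Edge-on-pile : ∀ {x u p} → u ∈ I → pileOf u ≡ p → ¬ Edge a x u → ∀ {v} → v ∈ I → pileOf v ≡ p → ¬ Edge a x v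
    ¬Edge-on-pile u∈I πu≡p ¬xu v∈I πv≡p with Feasible⇒one-per-pile u∈I v∈I (trans πu≡p (sym πv≡p))
    ... | refl = ¬xu

  increasing-set-ending-at : ∀ {p e} → InPile (piles a) p e →
    ∃ λ K → Feasible a K × (∀ u → u ∈ K → u ≡ e ⊎ Precedes a u e) × suc p ≤ ∣ K ∣
  increasing-set-ending-at {zero} {e} _ =
    ⁅ e ⁆ , Feasible-⁅⁆ e , (λ u u∈ → inj₁ (SP.x∈⁅y⁆⇒x≡y e u∈)) , NP.≤-reflexive (sym (SP.∣⁅x⁆∣≡1 e))
  increasing-set-ending-at {suc p} {e} e∈ with predecessor e∈
  ... | d , d∈ , d≺e with increasing-set-ending-at d∈
  ...   | K , fK , K≼d , p+1≤∣K∣ =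
          K ∪ ⁅ e ⁆ , Feasible-∪⁅⁆ fK K≺e , K∪e≼e , NP.≤-<-trans p+1≤∣K∣ (SP.p⊂q⇒∣p∣<∣q∣ K⊂K∪e)
    where
    K≺e : ∀ u → u ∈ K → Precedes a u e
    K≺e u u∈K with K≼d u u∈K
    ... | inj₁ refl = d≺e
    ... | inj₂ u≺d  = Precedes-trans u≺d d≺e

    K∪e≼e : ∀ u → u ∈ K ∪ ⁅ e ⁆ → u ≡ e ⊎ Precedes a u e
    K∪e≼e u u∈ with SP.x∈p∪q⁻ K ⁅ e ⁆ u∈
    ... | inj₁ u∈K = inj₂ (K≺e u u∈K)
    ... | inj₂ u∈e = inj₁ (SP.x∈⁅y⁆⇒x≡y e u∈e)

    K⊂K∪e : K ⊂ K ∪ ⁅ e ⁆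
    K⊂K∪e = SP.p⊆p∪q ⁅ e ⁆ , e , SP.x∈p∪q⁺ (inj₂ (SP.x∈⁅x⁆ e)) , λ e∈K → NP.<-irrefl refl (proj₁ (K≺e e e∈K))

  MaxFeasible-meets-every-pile : ∀ {I} → MaxFeasible a I → ∀ {p} → p < #piles → ∃ λ u → u ∈ I × pileOf u ≡ p
  MaxFeasible-meets-every-pile {I} (fI , maxI) {p} p<#piles
    with FP.any? (λ u → (u SP.∈? I) ×-dec (pileOf u NP.≟ p)) | <⇒≡suc p<#piles
  ... | yes found | _ = found
  ... | no  none  | q , #piles≡1+q with OnTop-exists well-formed (subst (q <_) (sym #piles≡1+q) (NP.n<1+n q))
  ...   | t , t-top with increasing-set-ending-at (OnTop⇒InPile t-top)
  ...     | K , fK , _ , q+1≤∣K∣ = ⊥-elim (NP.<-irrefl refl (begin-strict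
          ∣ I ∣       <⟨ I-misses-pile ⟩
          #piles      ≡⟨ #piles≡1+q ⟩
          suc q       ≤⟨ q+1≤∣K∣ ⟩
          ∣ K ∣       ≤⟨ maxI K fK ⟩
          ∣ I ∣       ∎))
    where
    open NP.≤-Reasoning
    I-misses-pile : ∣ I ∣ < #piles
    I-misses-pile = increasing-below-avoiding⇒∣∣< pileOf I p<#piles
                      (λ u u∈I πu≡p → none (u , u∈I , πu≡p)) (λ u _ → pileOf<#piles u) (Feasible⇒pileOf-increasing fI)

  pileOf-lookup : ∀ (t : Fin #piles) {e} → e ∈ₗ lookup (piles a) t → pileOf e ≡ toℕ t
  pileOf-lookup t e∈ = pileOf-unique (lookup⇒InPile (piles a) t e∈)

  pileOf⇒∈lookup : ∀ (t : Fin #piles) {e} → pileOf e ≡ toℕ t → e ∈ₗ lookup (piles a) t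
  pileOf⇒∈lookup t {e} πe≡t = InPile⇒lookup (piles a) t (subst (λ p → InPile (piles a) p e) πe≡t (InPile-pileOf e))

  pile-TwoElems : Bipartite a → ∀ (t : Fin #piles) {v w} → pileOf v ≡ toℕ t → pileOf w ≡ toℕ t → v ≢ w →
                  TwoElems a (lookup (piles a) t) v w
  pile-TwoElems bip t πv≡t πw≡t =
    bipartite-clique⇒TwoElems bip (lookup (piles a) t) (proj₂ (All.lookup well-formed (∈-lookup t)))
      (λ x∈ y∈ x≢y → pileOf≡⇒Edge x≢y (trans (pileOf-lookup t x∈) (sym (pileOf-lookup t y∈))))
      (pileOf⇒∈lookup t πv≡t) (pileOf⇒∈lookup t πw≡t)

  swap-across-pile : ∀ {I J i j t} → MaxFeasible a I → Feasible a J → i ∈ I → j ∈ J → pileOf i ≡ t → pileOf j ≡ t →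
    (∀ {w} → w ∈ I → pileOf w < t → w ∈ J) → (∀ {u} → u ∈ I → pileOf u ≡ suc t → ¬ Edge a j u) →
    Feasible a ((I - i) ∪ ⁅ j ⁆)
  swap-across-pile {I} {i = i} {j} {t} maxI@(fI , _) fJ i∈I j∈J πi≡t πj≡t I⊆J-left j-next =
    swap-feasible a-injective i j fI no-edge-to-j
    where
    no-edge-to-j : ∀ w → w ∈ I → w ≢ i → ¬ Edge a w j
    no-edge-to-j w w∈I w≢i with NP.<-cmp (pileOf w) t
    ... | tri< πw<t _ _ = Feasible⇒¬Edge fJ (I⊆J-left w∈I πw<t) j∈J
    ... | tri≈ _ πw≡t _ = ⊥-elim (w≢i (Feasible⇒one-per-pile fI w∈I i∈I (trans πw≡t (sym πi≡t))))
    ... | tri> _ _ t<πw with MaxFeasible-meets-every-pile maxI (NP.≤-<-trans t<πw (pileOf<#piles w))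
    ...   | u , u∈I , πu≡t+1 = λ wj → Precedes⇒¬Edge j≺w (Edge-sym wj)
      where
      j≺u : Precedes a j u
      j≺u = pileOf<∧¬Edge⇒Precedes (subst₂ _<_ (sym πj≡t) (sym πu≡t+1) (NP.n<1+n t)) (j-next u∈I πu≡t+1)
      j≺w : Precedes a j w
      j≺w with Feasible⇒≡⊎Precedes fI u∈I w∈I (subst (_≤ pileOf w) (sym πu≡t+1) t<πw)
      ... | inj₁ refl = j≺u
      ... | inj₂ u≺w  = Precedes-trans j≺u u≺w

  consecutive-piles-square : ∀ {I J i j u v t} → Feasible a I → Feasible a J → i ∈ I → j ∈ J → u ∈ I → v ∈ J →
    pileOf i ≡ t → pileOf j ≡ t → pileOf u ≡ suc t → pileOf v ≡ suc t → Edge a j u → Edge a i v →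
    u ≢ v × C4 a i j u v
  consecutive-piles-square fI fJ i∈I j∈J u∈I v∈J πi≡t πj≡t πu≡t+1 πv≡t+1 ju iv =
    u≢v , pileOf≡⇒Edge i≢j (trans πi≡t (sym πj≡t)) , ju , pileOf≡⇒Edge u≢v (trans πu≡t+1 (sym πv≡t+1)) ,
    Edge-sym iv , ¬iu , ¬jv
    where
    ¬iu = Feasible⇒¬Edge fI i∈I u∈I
    ¬jv = Feasible⇒¬Edge fJ j∈J v∈J
    i≢j : _ ≢ _
    i≢j refl = ¬iu ju
    u≢v : _ ≢ _
    u≢v refl = ¬jv ju

  module LeftOfLeftmostMixed (bip : Bipartite a) {I J} (maxI : MaxFeasible a I) (maxJ : MaxFeasible a J)
           {t : Fin #piles} (unmixed : ∀ s → s F.< t → ¬ Mixed a I J (lookup (piles a) s)) where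

    shared : ∀ {w w′} → w ∈ I → w′ ∈ J → pileOf w ≡ pileOf w′ → pileOf w < toℕ t → w ≡ w′
    shared {w} {w′} w∈I w′∈J πw≡πw′ πw<t with w F.≟ w′
    ... | yes w≡w′ = w≡w′
    ... | no  w≢w′ = ⊥-elim (unmixed s (subst (_< toℕ t) πw≡s πw<t)
                              (w , w′ , pile-TwoElems bip s πw≡s (trans (sym πw≡πw′) πw≡s) w≢w′ , w∈I , w′∈J))
      where
      s = F.fromℕ< (pileOf<#piles w)
      πw≡s : pileOf w ≡ toℕ s
      πw≡s = sym (FP.toℕ-fromℕ< (pileOf<#piles w))

    I⊆J : ∀ {w} → w ∈ I → pileOf w < toℕ t → w ∈ J
    I⊆J {w} w∈I πw<t with MaxFeasible-meets-every-pile maxJ (pileOf<#piles w)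
    ... | w′ , w′∈J , πw′≡πw with shared w∈I w′∈J (sym πw′≡πw) πw<t
    ...   | refl = w′∈J

    J⊆I : ∀ {w} → w ∈ J → pileOf w < toℕ t → w ∈ I
    J⊆I {w} w∈J πw<t with MaxFeasible-meets-every-pile maxI (pileOf<#piles w)
    ... | w′ , w′∈I , πw′≡πw with shared w′∈I w∈J πw′≡πw (subst (_< toℕ t) (sym πw′≡πw) πw<t)
    ...   | refl = w′∈I

lemma4 : (n : ℕ) (a : Fin n → ℕ) →
    (∀ u → 1 ≤ a u) → (∀ u → a u ≤ n) → Injective _≡_ _≡_ a →
    Bipartite a →
    (I J : Subset n) → MaxFeasible a I → MaxFeasible a J →
    NoForbiddenPair a I J →
    (i j : Fin n) → LeftmostMixed a I J i j →
    Feasible a ((I - i) ∪ ⁅ j ⁆) ⊎ Feasible a ((J - j) ∪ ⁅ i ⁆)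
-- Only the distinctness of the values a u matters, not their range.
lemma4 n a _ _ a-injective bip I J maxI maxJ no-forbidden-pair i j (t , i-j , i∈I , j∈J , unmixed) = swap
  where
  open PileStructure a-injective
  open LeftOfLeftmostMixed bip maxI maxJ unmixed
  fI = proj₁ maxI
  fJ = proj₁ maxJ
  πi≡t : pileOf i ≡ toℕ t
  πi≡t = pileOf-lookup t (proj₁ (TwoElems⇒∈ {a = a} i-j))
  πj≡t : pileOf j ≡ toℕ t
  πj≡t = pileOf-lookup t (proj₂ (TwoElems⇒∈ {a = a} i-j))

  swap : Feasible a ((I - i) ∪ ⁅ j ⁆) ⊎ Feasible a ((J - j) ∪ ⁅ i ⁆)
  swap with suc (toℕ t) <? #piles
  ... | no t-last = inj₁ (swap-across-pile maxI fJ i∈I j∈J πi≡t πj≡t I⊆J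
                            (λ {u} _ πu≡t+1 → ⊥-elim (t-last (subst (_< #piles) πu≡t+1 (pileOf<#piles u)))))
  ... | yes t+1<#piles
    with MaxFeasible-meets-every-pile maxI t+1<#piles | MaxFeasible-meets-every-pile maxJ t+1<#piles
  ...   | u , u∈I , πu≡t+1 | v , v∈J , πv≡t+1 with Edge? j u | Edge? i v
  ...     | no ¬ju | _      = inj₁ (swap-across-pile maxI fJ i∈I j∈J πi≡t πj≡t I⊆J (¬Edge-on-pile fI u∈I πu≡t+1 ¬ju))
  ...     | yes _  | no ¬iv = inj₂ (swap-across-pile maxJ fI j∈J i∈I πj≡t πi≡t J⊆I (¬Edge-on-pile fJ v∈J πv≡t+1 ¬iv))
  ...     | yes ju | yes iv with consecutive-piles-square fI fJ i∈I j∈J u∈I v∈J πi≡t πj≡t πu≡t+1 πv≡t+1 ju iv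
  ...       | u≢v , square = ⊥-elim (no-forbidden-pair t s (NP.≤-reflexive (sym s≡t+1))
                                (i , j , i-j , i∈I , j∈J) (u , v , u-v , u∈I , v∈J) (i , j , u , v , i-j , u-v , inj₁ square))
    where
    s = F.fromℕ< t+1<#piles
    s≡t+1 = FP.toℕ-fromℕ< t+1<#piles
    u-v = pile-TwoElems bip s (trans πu≡t+1 (sym s≡t+1)) (trans πv≡t+1 (sym s≡t+1)) u≢v
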